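{- Let $(G,k)$ with $G=(V,E)$ be an instance of \textsc{Strong Triadic Closure}, let $M$ be a maximum matching of $G$, let $V_M$ be the set of endpoints of edges in $M$, let $I_2$ be the set of vertices $v\in V\setminus V_M$ for which there is an edge $\{u,w\}\in M$ with both $u$ and $w$ adjacent to $v$, and let $I_1:=V\setminus(I_2\cup V_M)$. Call two vertices of $I_1$ members of the same family if they have the same neighborhood, and for a family $F$ let $N(F)$ be the common neighborhood of its vertices. Then the following data reduction rule is safe (produces an equivalent instance): for every family $F$ of vertices in $I_1$ with $|F|>|N(F)|$, delete $|F|-|N(F)|$ of the vertices of $F$ and decrease $k$ by $(|F|-|N(F)|)\cdot|N(F)|$.
   Context: All graphs are finite, undirected and simple. A labeling of $G=(V,E)$ is a partition $(S_L,W_L)$ of $E$ into strong and weak edges; it is an STC-labeling if there are no strong edges $\{u,v\},\{v,w\}\in S_L$ with $\{u,w\}\notin E$. \textsc{Strong Triadic Closure}: given $G=(V,E)$ and $k\in\mathbb{N}$, decide whether $G$ has an STC-labeling with $|W_L|\le k$ (equivalently, with at least $\ell:=|E|-k$ strong edges). -}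

module Defs where

open import Data.Nat using (ℕ; _<ᵇ_; _+_)
open import Data.Bool using (Bool; true; false; _∧_; not; T; if_then_else_)
open import Data.Bool.Properties using () renaming (_≟_ to _≟ᵇ_)
open import Data.Fin using (Fin; toℕ)
open import Data.List using (List; map; allFin)
open import Data.Nat.ListAction using (sum)
open import Data.Bool.ListAction using (any; all)
open import Relation.Nullary using (¬_)
open import Relation.Nullary.Decidable using (⌊_⌋)
open import Relation.Binary.PropositionalEquality using (_≡_)
open import Data.Product using (Σ; _×_)

record Graph (n : ℕ) : Set where
  field
    adj    : Fin n → Fin n → Bool
    sym    : ∀ u v → adj u v ≡ adj v u
    irrefl : ∀ v → adj v v ≡ false
open Graph public

VSet : ℕ → Set
VSet n = Fin n → Bool

Rel₂ : ℕ → Set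
Rel₂ n = Fin n → Fin n → Bool

count : {n : ℕ} → VSet n → ℕ
count {n} P = sum (map (λ v → if P v then 1 else 0) (allFin n))

countPairs : {n : ℕ} → Rel₂ n → ℕ
countPairs {n} P =
  sum (map (λ u → sum (map (λ v → if (toℕ u <ᵇ toℕ v) ∧ P u v then 1 else 0)
                           (allFin n)))
           (allFin n))

deg : {n : ℕ} → Graph n → Fin n → ℕ
deg G v = count (adj G v)

record IsMatching {n : ℕ} (G : Graph n) (M : Rel₂ n) : Set where
  field
    m-sym  : ∀ u v → M u v ≡ M v u
    m-edge : ∀ u v → T (M u v) → T (adj G u v)
    m-uniq : ∀ u v w → T (M u v) → T (M u w) → v ≡ w

matchSize : {n : ℕ} → Rel₂ n → ℕ
matchSize M = countPairs M

IsMaximumMatching : {n : ℕ} → Graph n → Rel₂ n → Set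
IsMaximumMatching {n} G M =
  IsMatching G M × (∀ (M' : Rel₂ n) → IsMatching G M' → matchSize M' Data.Nat.≤ matchSize M)

inVM : {n : ℕ} → Rel₂ n → VSet n
inVM {n} M v = any (M v) (allFin n)

inI2 : {n : ℕ} → Graph n → Rel₂ n → VSet n
inI2 {n} G M v =
  not (inVM M v) ∧
  any (λ u → any (λ w → M u w ∧ adj G u v ∧ adj G w v) (allFin n)) (allFin n)

inI1 : {n : ℕ} → Graph n → Rel₂ n → VSet n
inI1 G M v = not (inVM M v) ∧ not (inI2 G M v)

sameNbhd : {n : ℕ} → Graph n → Rel₂ n
sameNbhd {n} G u v = all (λ x → ⌊ adj G u x ≟ᵇ adj G v x ⌋) (allFin n)

family : {n : ℕ} → Graph n → Rel₂ n → Fin n → VSet n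
family G M v u = inI1 G M u ∧ sameNbhd G u v

-- STC-labeling of the subgraph of G induced by the vertex set A, given by the
-- set S of strong edges (weak edges = remaining edges of G[A]).
record IsSTC {n : ℕ} (G : Graph n) (A : VSet n) (S : Rel₂ n) : Set where
  field
    s-sym  : ∀ u v → S u v ≡ S v u
    s-edge : ∀ u v → T (S u v) → T (adj G u v) × T (A u) × T (A v)
    s-stc  : ∀ u v w → T (S u v) → T (S v w) → ¬ (u ≡ w) → T (adj G u w)

weakCount : {n : ℕ} → Graph n → VSet n → Rel₂ n → ℕ
weakCount G A S = countPairs (λ u v → A u ∧ A v ∧ adj G u v ∧ not (S u v))

STCyes : {n : ℕ} → Graph n → VSet n → ℕ → Set
STCyes {n} G A k = Σ (Rel₂ n) λ S → IsSTC G A S × weakCount G A S Data.Nat.≤ k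

allV : {n : ℕ} → VSet n
allV _ = true

-- total decrease of k: Σ over deleted vertices of |N(v)|
-- (each deleted vertex of family F has exactly |N(F)| neighbours, so this equals
--  Σ_F (|F| - |N(F)|) · |N(F)|)
decrease : {n : ℕ} → Graph n → VSet n → ℕ
decrease {n} G D = sum (map (λ v → if D v then deg G v else 0) (allFin n))

-- (G[A], k - d) is a yes-instance, stated without truncated subtraction:
-- some STC-labeling of G[A] has |W| + d ≤ k  (i.e. |W| ≤ k - d over ℤ;
-- if d > k the reduced instance is a no-instance)
STCyesReduced : {n : ℕ} → Graph n → VSet n → ℕ → ℕ → Set
STCyesReduced {n} G A k d =
  Σ (Rel₂ n) λ S → IsSTC G A S × weakCount G A S + d Data.Nat.≤ k

-- Adjacent vertices of I₁ would enlarge the maximum matching M, so the deleted set D ⊆ I₁ is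
-- independent and `decrease G D` counts every edge at a deleted vertex exactly once. Hence a
-- labeling in which no deleted vertex carries a strong edge has exactly `decrease G D` more weak
-- edges in G than in G − D: this gives ⇐ directly, and ⇒ once every STC-labeling is turned into
-- such a labeling with the same number of weak edges. In an STC-labeling every neighbour of a family F sends at most one strong edge
-- into F (two would force an edge between twins), so at most |N(F)| members of F are covered by
-- strong edges. Exactly |N(F)| members of F survive the rule, so if a deleted d ∈ F is covered,
-- some surviving f ∈ F is not; swapping the twins d and f is an automorphism of G, keeps the
-- number of weak edges and strictly decreases the number of covered deleted vertices.
module Submission where

open import Defs
open import Data.Nat using (ℕ; _+_; _≤_; _∸_)
open import Data.Bool using (T; not; _∧_)
open import Data.Fin using (Fin)
open import Data.Product using (_×_)
open import Function.Bundles using (_⇔_)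
open import Relation.Binary.PropositionalEquality using (_≡_)

open import Data.Bool using (Bool; true; false; _∨_; if_then_else_)
open import Data.Bool.Properties
  using (T-∧; T-∨; T?; ∧-comm; ∨-comm; ∧-zeroʳ; ∧-identityʳ; ∧-distribʳ-∨) renaming (_≟_ to _≟ᵇ_)
open import Data.Empty using (⊥; ⊥-elim)
open import Data.Fin using (zero; suc; toℕ; punchIn)
open import Data.Fin.Properties using (_≟_; toℕ-injective; any?; suc-injective; 0≢1+n)
open import Data.Fin.Permutation as Perm using (Permutation; _⟨$⟩ʳ_; _⟨$⟩ˡ_)
import Data.Fin.Permutation.Components as Comp
open import Data.List using (map; tabulate; allFin)
open import Data.List.Properties using (map-tabulate)
open import Data.List.Relation.Unary.Any.Properties as Any using (any⁺; any⁻)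
open import Data.List.Relation.Unary.All.Properties as All using (all⁺; all⁻)
open import Data.Nat using (zero; suc; _<_; _<ᵇ_; z≤n; s≤s; ⌊_/2⌋)
open import Data.Nat.Induction using (<-wellFounded)
open import Data.Nat.ListAction using () renaming (sum to sumᴸ)
open import Data.Nat.Properties
  using ( +-0-commutativeMonoid; ≤-refl; ≤-trans; <-irrefl; <-asym; <-cmp; +-mono-≤; +-mono-<-≤
        ; +-identityʳ; +-monoʳ-<; +-cancelˡ-≡; m≤m+n; <ᵇ⇒<; <⇒<ᵇ; n≡⌊n+n/2⌋; m∸n≢0⇒n<m; m∸n+n≡m
        ; <⇒≤; module ≤-Reasoning)
open import Data.Product using (Σ; ∃; _,_; proj₁; proj₂)
open import Data.Sum using (_⊎_; inj₁; inj₂)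
open import Function using (_∘_; _on_; id; const; Equivalence)
open import Function.Bundles using (mk⇔)
open import Induction.WellFounded using (Acc; acc)
open import Relation.Binary using (tri<; tri≈; tri>)
open import Relation.Binary.PropositionalEquality as ≡
  using (refl; trans; cong; cong₂; subst; subst₂; _≢_; module ≡-Reasoning)
open import Relation.Nullary using (¬_; yes; no)
open import Relation.Nullary.Decidable using (⌊_⌋; toWitness; fromWitness)

open import Algebra.Properties.CommutativeMonoid.Sum +-0-commutativeMonoid
  using (sum; sum-syntax; sum-cong-≗; sum-remove; sum-replicate-zero; ∑-distrib-+; ∑-comm; ∑-permute)

private
  variable
    n : ℕ

T-∧⁺ : {a b : Bool} → T a → T b → T (a ∧ b)
T-∧⁺ a b = Equivalence.from T-∧ (a , b)

T-∧⁻ : {a b : Bool} → T (a ∧ b) → T a × T b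
T-∧⁻ = Equivalence.to T-∧

T-not⇒¬T : {b : Bool} → T (not b) → ¬ T b
T-not⇒¬T {false} _ ()

¬T⇒T-not : {b : Bool} → ¬ T b → T (not b)
¬T⇒T-not {false} _  = _
¬T⇒T-not {true}  ¬b = ¬b _

𝟙 : Bool → ℕ
𝟙 b = if b then 1 else 0

𝟙-mono : {a b : Bool} → (T a → T b) → 𝟙 a ≤ 𝟙 b
𝟙-mono {false}        _   = z≤n
𝟙-mono {true} {true}  _   = ≤-refl
𝟙-mono {true} {false} a⇒b = ⊥-elim (a⇒b _)

𝟙-split : ∀ a b → 𝟙 a ≡ 𝟙 (a ∧ b) + 𝟙 (a ∧ not b)
𝟙-split false _     = refl
𝟙-split true  true  = refl
𝟙-split true  false = refl

𝟙-∧-+ : ∀ l {p q r} → 𝟙 p + 𝟙 q ≡ 𝟙 r → 𝟙 (l ∧ p) + 𝟙 (l ∧ q) ≡ 𝟙 (l ∧ r)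
𝟙-∧-+ false _ = refl
𝟙-∧-+ true  e = e

𝟙-∨-disjoint : {a b : Bool} → (T a → T b → ⊥) → 𝟙 a + 𝟙 b ≡ 𝟙 (a ∨ b)
𝟙-∨-disjoint {false}        _        = refl
𝟙-∨-disjoint {true} {false} _        = refl
𝟙-∨-disjoint {true} {true}  disjoint = ⊥-elim (disjoint _ _)

-- The hypothesis 0 < a excludes the truncated case c ≤ m of c ∸ m.
∸-complement : ∀ {a b c m} → c ≡ a + b → a ≡ c ∸ m → 0 < a → b ≡ m
∸-complement {a} {b} {c} {m} c≡a+b a≡c∸m 0<a = +-cancelˡ-≡ a b m (begin
  a + b      ≡⟨ c≡a+b ⟨
  c          ≡⟨ m∸n+n≡m (<⇒≤ m<c) ⟨
  c ∸ m + m  ≡⟨ cong (_+ m) a≡c∸m ⟨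
  a + m      ∎)
  where
  open ≡-Reasoning
  m<c : m < c
  m<c = m∸n≢0⇒n<m (λ c∸m≡0 → <-irrefl (≡.sym (trans a≡c∸m c∸m≡0)) 0<a)

+-double-injective : ∀ {a b} → a + a ≡ b + b → a ≡ b
+-double-injective {a} {b} e = trans (n≡⌊n+n/2⌋ a) (trans (cong ⌊_/2⌋ e) (≡.sym (n≡⌊n+n/2⌋ b)))

∑-mono-≤ : {f g : Fin n → ℕ} → (∀ i → f i ≤ g i) → sum f ≤ sum g
∑-mono-≤ {zero}  f≤g = z≤n
∑-mono-≤ {suc n} f≤g = +-mono-≤ (f≤g zero) (∑-mono-≤ (f≤g ∘ suc))

∑-mono-< : {f g : Fin n → ℕ} (i : Fin n) → (∀ j → f j ≤ g j) → f i < g i → sum f < sum g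
∑-mono-< {suc n} {f} {g} i f≤g fi<gi = begin-strict
  sum f                     ≡⟨ sum-remove f ⟩
  f i + sum (f ∘ punchIn i)  <⟨ +-mono-<-≤ fi<gi (∑-mono-≤ (f≤g ∘ punchIn i)) ⟩
  g i + sum (g ∘ punchIn i)  ≡⟨ sum-remove g ⟨
  sum g                     ∎
  where open ≤-Reasoning

term≤∑ : (f : Fin n → ℕ) (i : Fin n) → f i ≤ sum f
term≤∑ {suc n} f i = subst (f i ≤_) (≡.sym (sum-remove f)) (m≤m+n (f i) _)

∑∑-distrib-+ : ∀ {m} (f g : Fin m → Fin n → ℕ) →
  ∑[ i < m ] ∑[ j < n ] (f i j + g i j) ≡ ∑[ i < m ] ∑[ j < n ] f i j + ∑[ i < m ] ∑[ j < n ] g i j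
∑∑-distrib-+ f g = trans (sum-cong-≗ λ i → ∑-distrib-+ (f i) (g i)) (∑-distrib-+ (sum ∘ f) (sum ∘ g))

𝟙≤∑𝟙 : {a : Bool} (P : Fin n → Bool) → (T a → ∃ λ i → T (P i)) → 𝟙 a ≤ ∑[ i < n ] 𝟙 (P i)
𝟙≤∑𝟙 {a = false} P witness = z≤n
𝟙≤∑𝟙 {a = true}  P witness = let i , p = witness _ in
  ≤-trans (𝟙-mono {true} (const p)) (term≤∑ (𝟙 ∘ P) i)

∑𝟙-unique≤𝟙 : (P : Fin n → Bool) (b : Bool) → (∀ i → T (P i) → T b) →
  (∀ i j → T (P i) → T (P j) → i ≡ j) → ∑[ i < n ] 𝟙 (P i) ≤ 𝟙 b
∑𝟙-unique≤𝟙 {zero}  P b P⇒b unique = z≤n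
∑𝟙-unique≤𝟙 {suc n} P b P⇒b unique with P zero in P₀
... | false = ∑𝟙-unique≤𝟙 (P ∘ suc) b (P⇒b ∘ suc) (λ i j p q → suc-injective (unique _ _ p q))
... | true  = ≤-trans (s≤s rest≤0) (𝟙-mono {true} {b} (const (P⇒b zero T-P₀)))
  where
  T-P₀ : T (P zero)
  T-P₀ = subst T (≡.sym P₀) _
  rest≤0 : ∑[ i < n ] 𝟙 (P (suc i)) ≤ 𝟙 false
  rest≤0 = ∑𝟙-unique≤𝟙 (P ∘ suc) false (λ i p → 0≢1+n (unique zero (suc i) T-P₀ p))
             (λ i j p q → suc-injective (unique _ _ p q))

sumᴸ-tabulate : (f : Fin n → ℕ) → sumᴸ (tabulate f) ≡ sum f
sumᴸ-tabulate {zero}  f = refl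
sumᴸ-tabulate {suc n} f = cong (f zero +_) (sumᴸ-tabulate (f ∘ suc))

sumᴸ-map-allFin : (f : Fin n → ℕ) → sumᴸ (map f (allFin n)) ≡ sum f
sumᴸ-map-allFin f = trans (cong sumᴸ (map-tabulate id f)) (sumᴸ-tabulate f)

count≡∑ : (P : VSet n) → count P ≡ ∑[ v < n ] 𝟙 (P v)
count≡∑ P = sumᴸ-map-allFin (𝟙 ∘ P)

count-pos : (P : VSet n) (i : Fin n) → T (P i) → 0 < count P
count-pos P i p = subst (0 <_) (≡.sym (count≡∑ P))
  (≤-trans (𝟙-mono {true} {P i} (const p)) (term≤∑ (𝟙 ∘ P) i))

count-mono-< : {P Q : VSet n} (i : Fin n) → (∀ v → T (P v) → T (Q v)) →
  ¬ T (P i) → T (Q i) → count P < count Q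
count-mono-< {P = P} {Q} i P⇒Q ¬Pi Qi = subst₂ _<_ (≡.sym (count≡∑ P)) (≡.sym (count≡∑ Q))
  (∑-mono-< i (λ v → 𝟙-mono (P⇒Q v)) (𝟙-< ¬Pi Qi))
  where
  𝟙-< : {a b : Bool} → ¬ T a → T b → 𝟙 a < 𝟙 b
  𝟙-< {false} {true} _  _ = s≤s z≤n
  𝟙-< {true}         ¬a _ = ⊥-elim (¬a _)

count-split : (P Q : VSet n) → count P ≡ count (λ v → P v ∧ Q v) + count (λ v → P v ∧ not (Q v))
count-split {n} P Q = begin
  count P                                       ≡⟨ count≡∑ P ⟩
  ∑[ v < n ] 𝟙 (P v)                            ≡⟨ sum-cong-≗ (λ v → 𝟙-split (P v) (Q v)) ⟩
  ∑[ v < n ] (𝟙 (P∧Q v) + 𝟙 (P∧¬Q v))           ≡⟨ ∑-distrib-+ (𝟙 ∘ P∧Q) (𝟙 ∘ P∧¬Q) ⟩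
  ∑[ v < n ] 𝟙 (P∧Q v) + ∑[ v < n ] 𝟙 (P∧¬Q v)  ≡⟨ cong₂ _+_ (count≡∑ P∧Q) (count≡∑ P∧¬Q) ⟨
  count P∧Q + count P∧¬Q                        ∎
  where
  open ≡-Reasoning
  P∧Q P∧¬Q : VSet n
  P∧Q  v = P v ∧ Q v
  P∧¬Q v = P v ∧ not (Q v)

lt : Fin n → Fin n → Bool
lt u v = toℕ u <ᵇ toℕ v

lt-asym : (u v : Fin n) → T (lt u v) → T (lt v u) → ⊥
lt-asym u v p q = <-asym (<ᵇ⇒< (toℕ u) (toℕ v) p) (<ᵇ⇒< (toℕ v) (toℕ u) q)

lt-trichotomy : (u v : Fin n) → T (lt u v) ⊎ u ≡ v ⊎ T (lt v u)
lt-trichotomy u v with <-cmp (toℕ u) (toℕ v)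
... | tri< u<v _ _ = inj₁ (<⇒<ᵇ u<v)
... | tri≈ _ u≡v _ = inj₂ (inj₁ (toℕ-injective u≡v))
... | tri> _ _ v<u = inj₂ (inj₂ (<⇒<ᵇ v<u))

𝟙-lt-split : (u v : Fin n) (b : Bool) → (u ≡ v → b ≡ false) → 𝟙 (lt u v ∧ b) + 𝟙 (lt v u ∧ b) ≡ 𝟙 b
𝟙-lt-split u v b diagonal with lt u v in uv | lt v u in vu | lt-trichotomy u v
... | true  | true  | _ = ⊥-elim (lt-asym u v (subst T (≡.sym uv) _) (subst T (≡.sym vu) _))
... | true  | false | _ = +-identityʳ (𝟙 b)
... | false | true  | _ = refl
... | false | false | inj₂ (inj₁ u≡v) rewrite diagonal u≡v = refl

countPairs≡∑ : (P : Rel₂ n) → countPairs P ≡ ∑[ u < n ] ∑[ v < n ] 𝟙 (lt u v ∧ P u v)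
countPairs≡∑ P = trans (sumᴸ-map-allFin (λ u → sumᴸ (map (λ v → 𝟙 (lt u v ∧ P u v)) (allFin _))))
  (sum-cong-≗ λ u → sumᴸ-map-allFin (λ v → 𝟙 (lt u v ∧ P u v)))

countPairs-pos-ordered : (P : Rel₂ n) {u v : Fin n} → T (lt u v) → T (P u v) → 0 < countPairs P
countPairs-pos-ordered P {u} {v} l p = subst (0 <_) (≡.sym (countPairs≡∑ P))
  (≤-trans (𝟙-mono {true} (const (T-∧⁺ l p))) (≤-trans (term≤∑ _ v) (term≤∑ _ u)))

countPairs-pos : (P : Rel₂ n) → (∀ u v → P u v ≡ P v u) → {u v : Fin n} →
  u ≢ v → T (P u v) → 0 < countPairs P
countPairs-pos P P-sym {u} {v} u≢v p with lt-trichotomy u v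
... | inj₁ u<v        = countPairs-pos-ordered P u<v p
... | inj₂ (inj₁ u≡v) = ⊥-elim (u≢v u≡v)
... | inj₂ (inj₂ v<u) = countPairs-pos-ordered P v<u (subst T (P-sym u v) p)

countPairs-+ : {P Q R : Rel₂ n} → (∀ u v → 𝟙 (P u v) + 𝟙 (Q u v) ≡ 𝟙 (R u v)) →
  countPairs P + countPairs Q ≡ countPairs R
countPairs-+ {n} {P} {Q} {R} pointwise = begin
  countPairs P + countPairs Q
    ≡⟨ cong₂ _+_ (countPairs≡∑ P) (countPairs≡∑ Q) ⟩
  ∑[ u < n ] ∑[ v < n ] 𝟙 (lt u v ∧ P u v) + ∑[ u < n ] ∑[ v < n ] 𝟙 (lt u v ∧ Q u v)
    ≡⟨ ∑∑-distrib-+ (λ u v → 𝟙 (lt u v ∧ P u v)) (λ u v → 𝟙 (lt u v ∧ Q u v)) ⟨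
  ∑[ u < n ] ∑[ v < n ] (𝟙 (lt u v ∧ P u v) + 𝟙 (lt u v ∧ Q u v))
    ≡⟨ sum-cong-≗ (λ u → sum-cong-≗ λ v → 𝟙-∧-+ (lt u v) (pointwise u v)) ⟩
  ∑[ u < n ] ∑[ v < n ] 𝟙 (lt u v ∧ R u v)
    ≡⟨ countPairs≡∑ R ⟨
  countPairs R
    ∎
  where open ≡-Reasoning

countPairs-split : (R : Rel₂ n) → (∀ u v → R u v ≡ R v u) → (∀ v → R v v ≡ false) → (Q : VSet n) →
  countPairs (λ u v → Q u ∧ R u v) + countPairs (λ u v → Q v ∧ R u v) ≡ ∑[ u < n ] ∑[ v < n ] 𝟙 (Q u ∧ R u v)
countPairs-split {n} R R-sym R-irrefl Q = begin
  countPairs (λ u v → Q u ∧ R u v) + countPairs (λ u v → Q v ∧ R u v)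
    ≡⟨ cong₂ _+_ (countPairs≡∑ (λ u v → Q u ∧ R u v))
                 (trans (countPairs≡∑ (λ u v → Q v ∧ R u v)) (∑-comm (λ u v → 𝟙 (lt u v ∧ (Q v ∧ R u v))))) ⟩
  ∑[ u < n ] ∑[ v < n ] 𝟙 (lt u v ∧ (Q u ∧ R u v)) + ∑[ u < n ] ∑[ v < n ] 𝟙 (lt v u ∧ (Q u ∧ R v u))
    ≡⟨ ∑∑-distrib-+ (λ u v → 𝟙 (lt u v ∧ (Q u ∧ R u v))) (λ u v → 𝟙 (lt v u ∧ (Q u ∧ R v u))) ⟨
  ∑[ u < n ] ∑[ v < n ] (𝟙 (lt u v ∧ (Q u ∧ R u v)) + 𝟙 (lt v u ∧ (Q u ∧ R v u)))
    ≡⟨ sum-cong-≗ (λ u → sum-cong-≗ λ v → both-orders u v) ⟩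
  ∑[ u < n ] ∑[ v < n ] 𝟙 (Q u ∧ R u v)
    ∎
  where
  open ≡-Reasoning
  both-orders : ∀ u v → 𝟙 (lt u v ∧ (Q u ∧ R u v)) + 𝟙 (lt v u ∧ (Q u ∧ R v u)) ≡ 𝟙 (Q u ∧ R u v)
  both-orders u v rewrite R-sym v u =
    𝟙-lt-split u v (Q u ∧ R u v) λ { refl → trans (cong (Q u ∧_) (R-irrefl u)) (∧-zeroʳ (Q u)) }

countPairs-double : (R : Rel₂ n) → (∀ u v → R u v ≡ R v u) → (∀ v → R v v ≡ false) →
  countPairs R + countPairs R ≡ ∑[ u < n ] ∑[ v < n ] 𝟙 (R u v)
countPairs-double R R-sym R-irrefl = countPairs-split R R-sym R-irrefl (const true)

-- For a labeling S, `inVM S v` says that v is an endpoint of a strong edge.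
inVM-intro : (R : Rel₂ n) {v w : Fin n} → T (R v w) → T (inVM R v)
inVM-intro R {v} {w} r = any⁺ (R v) (Any.tabulate⁺ w r)

inVM-witness : (R : Rel₂ n) {v : Fin n} → T (inVM R v) → ∃ λ w → T (R v w)
inVM-witness R {v} c = Any.tabulate⁻ (any⁻ (R v) (allFin _) c)

inVM-on : (R : Rel₂ n) (g : Fin n → Fin n) {x : Fin n} → T (inVM (R on g) x) → T (inVM R (g x))
inVM-on R g c = inVM-intro R (proj₂ (inVM-witness (R on g) c))

not-inVM : (R : Rel₂ n) {v w : Fin n} → T (not (inVM R v)) → ¬ T (R v w)
not-inVM R free r = T-not⇒¬T free (inVM-intro R r)

Twins : Graph n → Fin n → Fin n → Set
Twins G a b = ∀ y → adj G a y ≡ adj G b y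

sameNbhd⇒Twins : (G : Graph n) {u v : Fin n} → T (sameNbhd G u v) → Twins G u v
sameNbhd⇒Twins G s y = toWitness (All.tabulate⁻ (all⁺ _ (allFin _) s) y)

sameNbhd-refl : (G : Graph n) (u : Fin n) → T (sameNbhd G u u)
sameNbhd-refl G u =
  all⁻ (λ y → ⌊ adj G u y ≟ᵇ adj G u y ⌋) (All.tabulate⁺ {f = id} λ y → fromWitness refl)

twins-nonadjacent : (G : Graph n) {a b : Fin n} → Twins G a b → adj G a b ≡ false
twins-nonadjacent G {a} {b} a~b = trans (a~b b) (irrefl G b)

Independent : Graph n → VSet n → Set
Independent G D = ∀ u v → T (D u) → T (D v) → adj G u v ≡ false

edgeRel : Fin n → Fin n → Rel₂ n
edgeRel u v a b = (⌊ a ≟ u ⌋ ∧ ⌊ b ≟ v ⌋) ∨ (⌊ a ≟ v ⌋ ∧ ⌊ b ≟ u ⌋)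

edgeRel-sym : (u v a b : Fin n) → edgeRel u v a b ≡ edgeRel u v b a
edgeRel-sym u v a b = trans (∨-comm (⌊ a ≟ u ⌋ ∧ ⌊ b ≟ v ⌋) (⌊ a ≟ v ⌋ ∧ ⌊ b ≟ u ⌋))
  (cong₂ _∨_ (∧-comm ⌊ a ≟ v ⌋ ⌊ b ≟ u ⌋) (∧-comm ⌊ a ≟ u ⌋ ⌊ b ≟ v ⌋))

edgeRel-self : (u v : Fin n) → T (edgeRel u v u v)
edgeRel-self u v with u ≟ u | v ≟ v
... | yes _  | yes _  = _
... | no u≢u | _      = ⊥-elim (u≢u refl)
... | yes _  | no v≢v = ⊥-elim (v≢v refl)

edgeRel-endpoints : {u v a b : Fin n} → T (edgeRel u v a b) → (a ≡ u × b ≡ v) ⊎ (a ≡ v × b ≡ u)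
edgeRel-endpoints {u = u} {v} {a} {b} e with Equivalence.to (T-∨ {⌊ a ≟ u ⌋ ∧ ⌊ b ≟ v ⌋}) e
... | inj₁ uv = let a≡u , b≡v = T-∧⁻ {⌊ a ≟ u ⌋} uv in inj₁ (toWitness a≡u , toWitness b≡v)
... | inj₂ vu = let a≡v , b≡u = T-∧⁻ {⌊ a ≟ v ⌋} vu in inj₂ (toWitness a≡v , toWitness b≡u)

module AddFreeEdge {G : Graph n} {M : Rel₂ n} (isM : IsMatching G M) {u v : Fin n}
  (u-free : T (not (inVM M u))) (v-free : T (not (inVM M v))) (uv : T (adj G u v)) where

  M⁺ : Rel₂ n
  M⁺ a b = M a b ∨ edgeRel u v a b

  private
    free-endpoint : ∀ {a b c} → T (M a b) → (a ≡ u × c ≡ v) ⊎ (a ≡ v × c ≡ u) → ⊥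
    free-endpoint m (inj₁ (refl , _)) = not-inVM M u-free m
    free-endpoint m (inj₂ (refl , _)) = not-inVM M v-free m

    old-or-new : ∀ {a b} → T (M⁺ a b) → T (M a b) ⊎ (a ≡ u × b ≡ v) ⊎ (a ≡ v × b ≡ u)
    old-or-new m with Equivalence.to T-∨ m
    ... | inj₁ old = inj₁ old
    ... | inj₂ new = inj₂ (edgeRel-endpoints new)

  isMatching : IsMatching G M⁺
  isMatching .IsMatching.m-sym a b = cong₂ _∨_ (IsMatching.m-sym isM a b) (edgeRel-sym u v a b)
  isMatching .IsMatching.m-edge a b m with old-or-new m
  ... | inj₁ old                  = IsMatching.m-edge isM a b old
  ... | inj₂ (inj₁ (refl , refl)) = uv
  ... | inj₂ (inj₂ (refl , refl)) = subst T (sym G u v) uv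
  isMatching .IsMatching.m-uniq a b c m m′ with old-or-new m | old-or-new m′
  ... | inj₁ ab | inj₁ ac = IsMatching.m-uniq isM a b c ab ac
  ... | inj₁ ab | inj₂ ac = ⊥-elim (free-endpoint ab ac)
  ... | inj₂ ab | inj₁ ac = ⊥-elim (free-endpoint ac ab)
  ... | inj₂ (inj₁ (refl , refl)) | inj₂ (inj₁ (_ , refl))   = refl
  ... | inj₂ (inj₂ (refl , refl)) | inj₂ (inj₂ (_ , refl))   = refl
  ... | inj₂ (inj₁ (refl , refl)) | inj₂ (inj₂ (a≡v , refl)) = ≡.sym a≡v
  ... | inj₂ (inj₂ (refl , refl)) | inj₂ (inj₁ (a≡u , refl)) = ≡.sym a≡u

  larger : matchSize M < matchSize M⁺
  larger = begin-strict
    matchSize M                             ≡⟨ +-identityʳ _ ⟨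
    matchSize M + 0                         <⟨ +-monoʳ-< (matchSize M) new-edge-counted ⟩
    matchSize M + countPairs (edgeRel u v)  ≡⟨ countPairs-+ {P = M} {edgeRel u v} {M⁺} disjoint ⟩
    matchSize M⁺                            ∎
    where
    open ≤-Reasoning
    new-edge-counted : 0 < countPairs (edgeRel u v)
    new-edge-counted = countPairs-pos (edgeRel u v) (edgeRel-sym u v) {u} {v}
      (λ { refl → subst T (irrefl G u) uv }) (edgeRel-self u v)
    disjoint : ∀ a b → 𝟙 (M a b) + 𝟙 (edgeRel u v a b) ≡ 𝟙 (M⁺ a b)
    disjoint a b = 𝟙-∨-disjoint (λ m e → free-endpoint m (edgeRel-endpoints e))

unmatched-nonadjacent : {G : Graph n} {M : Rel₂ n} → IsMaximumMatching G M → {u v : Fin n} →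
  T (not (inVM M u)) → T (not (inVM M v)) → adj G u v ≡ false
unmatched-nonadjacent {G = G} (isM , maximal) {u} {v} u-free v-free with adj G u v in uv
... | false = refl
... | true  = ⊥-elim (<-irrefl refl (≤-trans larger (maximal M⁺ isMatching)))
  where open AddFreeEdge isM u-free v-free (subst T (≡.sym uv) _)

Automorphism : Graph n → Permutation n n → Set
Automorphism G π = ∀ u v → adj G (π ⟨$⟩ʳ u) (π ⟨$⟩ʳ v) ≡ adj G u v

transpose-twin : (G : Graph n) {i j : Fin n} → Twins G i j → ∀ x → Twins G (Comp.transpose i j x) x
transpose-twin G {i} {j} i~j x with x ≟ i
... | yes refl = λ y → ≡.sym (i~j y)
... | no _ with x ≟ j
...   | yes refl = i~j
...   | no _     = λ _ → refl

twins-transpose-automorphism : (G : Graph n) {i j : Fin n} → Twins G i j →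
  Automorphism G (Perm.transpose i j)
twins-transpose-automorphism G {i} {j} i~j u v = begin
  adj G (τ u) (τ v)  ≡⟨ transpose-twin G i~j u (τ v) ⟩
  adj G u (τ v)      ≡⟨ sym G u (τ v) ⟩
  adj G (τ v) u      ≡⟨ transpose-twin G i~j v u ⟩
  adj G v u          ≡⟨ sym G v u ⟩
  adj G u v          ∎
  where
  open ≡-Reasoning
  τ = Comp.transpose i j

weakRel : Graph n → Rel₂ n → Rel₂ n
weakRel G S u v = adj G u v ∧ not (S u v)

module _ {G : Graph n} (π : Permutation n n) (aut : Automorphism G π)
  {S : Rel₂ n} (stc : IsSTC G allV S) where

  private
    π· = π ⟨$⟩ʳ_
    π·-injective : ∀ {u w} → π· u ≡ π· w → u ≡ w
    π·-injective e = trans (≡.sym (Perm.inverseˡ π)) (trans (cong (π ⟨$⟩ˡ_) e) (Perm.inverseˡ π))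

  IsSTC-permute : IsSTC G allV (S on π·)
  IsSTC-permute .IsSTC.s-sym u v = IsSTC.s-sym stc (π· u) (π· v)
  IsSTC-permute .IsSTC.s-edge u v s = subst T (aut u v) (proj₁ (IsSTC.s-edge stc (π· u) (π· v) s)) , _ , _
  IsSTC-permute .IsSTC.s-stc u v w s s′ u≢w =
    subst T (aut u w) (IsSTC.s-stc stc (π· u) (π· v) (π· w) s s′ (u≢w ∘ π·-injective))

  -- countPairs is not permutation invariant term by term, but its double, the sum over all
  -- ordered pairs, is.
  weakCount-permute : weakCount G allV (S on π·) ≡ weakCount G allV S
  weakCount-permute = +-double-injective (begin
    countPairs W′ + countPairs W′
      ≡⟨ countPairs-double W′ (weak-sym (S on π·) (IsSTC.s-sym IsSTC-permute)) (weak-irrefl (S on π·)) ⟩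
    ∑[ u < n ] ∑[ v < n ] 𝟙 (W′ u v)
      ≡⟨ sum-cong-≗ (λ u → sum-cong-≗ λ v →
           cong (λ a → 𝟙 (a ∧ not (S (π· u) (π· v)))) (≡.sym (aut u v))) ⟩
    ∑[ u < n ] ∑[ v < n ] 𝟙 (W (π· u) (π· v))
      ≡⟨ sum-cong-≗ (λ u → ∑-permute (λ v → 𝟙 (W (π· u) v)) π) ⟨
    ∑[ u < n ] ∑[ v < n ] 𝟙 (W (π· u) v)
      ≡⟨ ∑-permute (λ u → ∑[ v < n ] 𝟙 (W u v)) π ⟨
    ∑[ u < n ] ∑[ v < n ] 𝟙 (W u v)
      ≡⟨ countPairs-double W (weak-sym S (IsSTC.s-sym stc)) (weak-irrefl S) ⟨
    countPairs W + countPairs W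
      ∎)
    where
    open ≡-Reasoning
    W W′ : Rel₂ n
    W  = weakRel G S
    W′ = weakRel G (S on π·)
    weak-sym : (R : Rel₂ n) → (∀ u v → R u v ≡ R v u) → ∀ u v → weakRel G R u v ≡ weakRel G R v u
    weak-sym R R-sym u v = cong₂ (λ a r → a ∧ not r) (sym G u v) (R-sym u v)
    weak-irrefl : (R : Rel₂ n) → ∀ v → weakRel G R v v ≡ false
    weak-irrefl R v = cong (_∧ not (R v v)) (irrefl G v)

covered-twins≤deg : {G : Graph n} {A : VSet n} {S : Rel₂ n} → IsSTC G A S →
  (F : VSet n) {c : Fin n} → (∀ a → T (F a) → Twins G a c) → count (λ a → F a ∧ inVM S a) ≤ deg G c
covered-twins≤deg {n} {G} {S = S} stc F {c} twin = begin
  count (λ a → F a ∧ inVM S a)           ≡⟨ count≡∑ (λ a → F a ∧ inVM S a) ⟩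
  ∑[ a < n ] 𝟙 (F a ∧ inVM S a)          ≤⟨ ∑-mono-≤ (λ a → 𝟙≤∑𝟙 (λ x → F a ∧ S a x) (strong-edge-at a)) ⟩
  ∑[ a < n ] ∑[ x < n ] 𝟙 (F a ∧ S a x)  ≡⟨ ∑-comm (λ a x → 𝟙 (F a ∧ S a x)) ⟩
  ∑[ x < n ] ∑[ a < n ] 𝟙 (F a ∧ S a x)  ≤⟨ ∑-mono-≤ (λ x → ∑𝟙-unique≤𝟙 _ (adj G c x) (into-N x) (unique x)) ⟩
  ∑[ x < n ] 𝟙 (adj G c x)               ≡⟨ count≡∑ (adj G c) ⟨
  deg G c                                ∎
  where
  open ≤-Reasoning
  strong-edge-at : ∀ a → T (F a ∧ inVM S a) → ∃ λ x → T (F a ∧ S a x)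
  strong-edge-at a t = let Fa , covered = T-∧⁻ {F a} t
                           x , s        = inVM-witness S covered
                       in x , T-∧⁺ Fa s
  into-N : ∀ x a → T (F a ∧ S a x) → T (adj G c x)
  into-N x a t = let Fa , s = T-∧⁻ {F a} t
                 in subst T (twin a Fa x) (proj₁ (IsSTC.s-edge stc a x s))
  unique : ∀ x a a′ → T (F a ∧ S a x) → T (F a′ ∧ S a′ x) → a ≡ a′
  unique x a a′ t t′ with a ≟ a′
  ... | yes a≡a′ = a≡a′
  ... | no  a≢a′ = let Fa  , s  = T-∧⁻ {F a} t
                       Fa′ , s′ = T-∧⁻ {F a′} t′
                       a~a′     = λ y → trans (twin a Fa y) (≡.sym (twin a′ Fa′ y))
                   in ⊥-elim (subst T (twins-nonadjacent G a~a′)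
                        (IsSTC.s-stc stc a x a′ s (subst T (IsSTC.s-sym stc a′ x) s′) a≢a′))

uncovered-survivor : {G : Graph n} {S : Rel₂ n} → IsSTC G allV S → (F D : VSet n) {c : Fin n} →
  (∀ a → T (F a) → Twins G a c) → T (F c) → T (D c) → T (inVM S c) →
  count (λ u → F u ∧ D u) ≡ count F ∸ deg G c →
  ∃ λ f → T (F f ∧ not (D f) ∧ not (inVM S f))
uncovered-survivor {G = G} {S} stc F D {c} twin Fc Dc covered-c deleted
  with any? (λ f → T? (F f ∧ not (D f) ∧ not (inVM S f)))
... | yes found = found
... | no  none  = ⊥-elim (<-irrefl refl (begin-strict
  deg G c                        ≡⟨ survivors ⟨
  count (λ f → F f ∧ not (D f))  <⟨ count-mono-< c survivors-covered c-deleted (T-∧⁺ Fc covered-c) ⟩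
  count (λ f → F f ∧ inVM S f)   ≤⟨ covered-twins≤deg stc F twin ⟩
  deg G c                        ∎))
  where
  open ≤-Reasoning
  survivors : count (λ f → F f ∧ not (D f)) ≡ deg G c
  survivors = ∸-complement (count-split F D) deleted (count-pos (λ u → F u ∧ D u) c (T-∧⁺ Fc Dc))
  c-deleted : ¬ T (F c ∧ not (D c))
  c-deleted t = T-not⇒¬T (proj₂ (T-∧⁻ {F c} t)) Dc
  survivors-covered : ∀ f → T (F f ∧ not (D f)) → T (F f ∧ inVM S f)
  survivors-covered f t with T? (inVM S f)
  ... | yes covered  = T-∧⁺ (proj₁ (T-∧⁻ {F f} t)) covered
  ... | no  ¬covered = let Ff , kept = T-∧⁻ {F f} t in
                       ⊥-elim (none (f , T-∧⁺ Ff (T-∧⁺ kept (¬T⇒T-not ¬covered))))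

transpose-uncovered-decreases : {D : VSet n} {S : Rel₂ n} {d f : Fin n} →
  T (D d) → T (inVM S d) → T (not (D f)) → T (not (inVM S f)) →
  count (λ x → D x ∧ inVM (S on (Perm.transpose d f ⟨$⟩ʳ_)) x) < count (λ x → D x ∧ inVM S x)
transpose-uncovered-decreases {D = D} {S} {d} {f} Dd covered-d f-kept f-uncovered =
  count-mono-< {P = λ x → D x ∧ inVM (S on τ) x} {λ x → D x ∧ inVM S x} d still-covered
    (λ t → d-uncovered (inVM-on S τ {d} (proj₂ (T-∧⁻ {D d} t)))) (T-∧⁺ Dd covered-d)
  where
  τ = Comp.transpose d f
  moved : ∀ x → T (D x) → T (inVM S (τ x)) → T (inVM S x)
  moved x Dx covered with x ≟ d
  ... | yes refl = covered-d
  ... | no _ with x ≟ f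
  ...   | yes refl = ⊥-elim (T-not⇒¬T f-kept Dx)
  ...   | no _     = covered
  still-covered : ∀ x → T (D x ∧ inVM (S on τ) x) → T (D x ∧ inVM S x)
  still-covered x t = let Dx , covered = T-∧⁻ {D x} t in T-∧⁺ {D x} Dx (moved x Dx (inVM-on S τ {x} covered))
  d-uncovered : ¬ T (inVM S (τ d))
  d-uncovered with d ≟ d
  ... | yes _  = T-not⇒¬T f-uncovered
  ... | no d≢d = ⊥-elim (d≢d refl)

module _ {G : Graph n} {M : Rel₂ n} (maxM : IsMaximumMatching G M) {D : VSet n}
  (D⊆I₁ : ∀ v → T (D v) → T (inI1 G M v))
  (family-deleted : ∀ v → T (inI1 G M v) →
                      count (λ u → family G M v u ∧ D u) ≡ count (family G M v) ∸ deg G v)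
  where

  private
    coveredDeleted : Rel₂ n → ℕ
    coveredDeleted S = count (λ x → D x ∧ inVM S x)

    exchange : {S : Rel₂ n} → IsSTC G allV S → {d : Fin n} → T (D d) → T (inVM S d) →
      Σ (Rel₂ n) λ S′ → IsSTC G allV S′ × weakCount G allV S′ ≡ weakCount G allV S
                        × coveredDeleted S′ < coveredDeleted S
    exchange {S} stc {d} Dd covered-d =
      let f , t                = uncovered-survivor stc (family G M d) D family-twins
                                   (T-∧⁺ I₁d (sameNbhd-refl G d)) Dd covered-d (family-deleted d I₁d)
          Ff , rest            = T-∧⁻ {family G M d f} t
          f-kept , f-uncovered = T-∧⁻ {not (D f)} rest
          τ                    = Perm.transpose d f
          aut                  = twins-transpose-automorphism G (λ y → ≡.sym (family-twins f Ff y))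
      in (S on (τ ⟨$⟩ʳ_)) , IsSTC-permute τ aut stc , weakCount-permute τ aut stc
         , transpose-uncovered-decreases {D = D} {S} Dd covered-d f-kept f-uncovered
      where
      I₁d : T (inI1 G M d)
      I₁d = D⊆I₁ d Dd
      family-twins : ∀ a → T (family G M d a) → Twins G a d
      family-twins a t = sameNbhd⇒Twins G (proj₂ (T-∧⁻ {inI1 G M a} t))

  deleted-uncovered-labeling : {S : Rel₂ n} → IsSTC G allV S →
    Σ (Rel₂ n) λ S′ → IsSTC G allV S′ × weakCount G allV S′ ≡ weakCount G allV S
                      × (∀ u v → T (S′ u v) → T (not (D u)))
  deleted-uncovered-labeling {S} stc = go stc (<-wellFounded (coveredDeleted S))
    where
    go : {S : Rel₂ n} → IsSTC G allV S → Acc _<_ (coveredDeleted S) →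
      Σ (Rel₂ n) λ S′ → IsSTC G allV S′ × weakCount G allV S′ ≡ weakCount G allV S
                        × (∀ u v → T (S′ u v) → T (not (D u)))
    go {S} stc (acc smaller) with any? (λ d → T? (D d ∧ inVM S d))
    ... | no  none    = S , stc , refl , λ u v s → ¬T⇒T-not (λ Du → none (u , T-∧⁺ Du (inVM-intro S s)))
    ... | yes (d , t) =
      let Dd , covered-d           = T-∧⁻ {D d} t
          S′ , stc′ , w′≡w , fewer = exchange stc Dd covered-d
          S″ , stc″ , w″≡w′ , done = go stc′ (smaller fewer)
      in S″ , stc″ , trans w″≡w′ w′≡w , done

decrease≡countPairs : (G : Graph n) (D : VSet n) → Independent G D →
  decrease G D ≡ countPairs (λ u v → (D u ∨ D v) ∧ adj G u v)
decrease≡countPairs {n} G D independent = begin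
  decrease G D
    ≡⟨ sumᴸ-map-allFin (λ u → if D u then deg G u else 0) ⟩
  ∑[ u < n ] (if D u then deg G u else 0)
    ≡⟨ sum-cong-≗ degree-as-sum ⟩
  ∑[ u < n ] ∑[ v < n ] 𝟙 (D u ∧ adj G u v)
    ≡⟨ countPairs-split (adj G) (sym G) (irrefl G) D ⟨
  countPairs (λ u v → D u ∧ adj G u v) + countPairs (λ u v → D v ∧ adj G u v)
    ≡⟨ countPairs-+ {P = λ u v → D u ∧ adj G u v} {λ u v → D v ∧ adj G u v} one-deleted-end ⟩
  countPairs (λ u v → (D u ∨ D v) ∧ adj G u v)
    ∎
  where
  open ≡-Reasoning
  degree-as-sum : ∀ u → (if D u then deg G u else 0) ≡ ∑[ v < n ] 𝟙 (D u ∧ adj G u v)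
  degree-as-sum u with D u
  ... | true  = count≡∑ (adj G u)
  ... | false = ≡.sym (sum-replicate-zero n)
  one-deleted-end : ∀ u v → 𝟙 (D u ∧ adj G u v) + 𝟙 (D v ∧ adj G u v) ≡ 𝟙 ((D u ∨ D v) ∧ adj G u v)
  one-deleted-end u v =
    trans (𝟙-∨-disjoint both-ends) (cong 𝟙 (≡.sym (∧-distribʳ-∨ (adj G u v) (D u) (D v))))
    where
    both-ends : T (D u ∧ adj G u v) → T (D v ∧ adj G u v) → ⊥
    both-ends t t′ = let Du , uv = T-∧⁻ {D u} t in
      T-not⇒¬T (subst (T ∘ not) (≡.sym (independent u v Du (proj₁ (T-∧⁻ {D v} t′)))) _) uv

weakCount-split : (G : Graph n) (D : VSet n) (S : Rel₂ n) → Independent G D →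
  (∀ u v → T (S u v) → T (not (D u)) × T (not (D v))) →
  weakCount G allV S ≡ weakCount G (λ v → not (D v)) S + decrease G D
weakCount-split G D S independent kept = begin
  weakCount G allV S
    ≡⟨ countPairs-+ {P = λ u v → not (D u) ∧ not (D v) ∧ adj G u v ∧ not (S u v)}
                    {λ u v → (D u ∨ D v) ∧ adj G u v}
                    (λ u v → 𝟙-weak-split (D u) (D v) (adj G u v) (S u v) (kept u v)) ⟨
  weakCount G (λ v → not (D v)) S + countPairs (λ u v → (D u ∨ D v) ∧ adj G u v)
    ≡⟨ cong (weakCount G (λ v → not (D v)) S +_) (decrease≡countPairs G D independent) ⟨
  weakCount G (λ v → not (D v)) S + decrease G D
    ∎
  where
  open ≡-Reasoning
  𝟙-weak-split : ∀ du dv a s → (T s → T (not du) × T (not dv)) →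
    𝟙 (not du ∧ not dv ∧ a ∧ not s) + 𝟙 ((du ∨ dv) ∧ a) ≡ 𝟙 (a ∧ not s)
  𝟙-weak-split false false a s     _    = +-identityʳ _
  𝟙-weak-split true  dv    a false _    = cong 𝟙 (≡.sym (∧-identityʳ a))
  𝟙-weak-split false true  a false _    = cong 𝟙 (≡.sym (∧-identityʳ a))
  𝟙-weak-split true  dv    a true  kept = ⊥-elim (proj₁ (kept _))
  𝟙-weak-split false true  a true  kept = ⊥-elim (proj₂ (kept _))

IsSTC-mono : {G : Graph n} {A B : VSet n} {S : Rel₂ n} → (∀ v → T (A v) → T (B v)) →
  IsSTC G A S → IsSTC G B S
IsSTC-mono A⊆B stc .IsSTC.s-sym = IsSTC.s-sym stc
IsSTC-mono A⊆B stc .IsSTC.s-edge u v s = let uv , Au , Av = IsSTC.s-edge stc u v s in uv , A⊆B u Au , A⊆B v Av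
IsSTC-mono A⊆B stc .IsSTC.s-stc = IsSTC.s-stc stc

IsSTC-restrict : {G : Graph n} {A B : VSet n} {S : Rel₂ n} →
  (∀ u v → T (S u v) → T (A u) × T (A v)) → IsSTC G B S → IsSTC G A S
IsSTC-restrict inside stc .IsSTC.s-sym = IsSTC.s-sym stc
IsSTC-restrict inside stc .IsSTC.s-edge u v s = proj₁ (IsSTC.s-edge stc u v s) , inside u v s
IsSTC-restrict inside stc .IsSTC.s-stc = IsSTC.s-stc stc

proposition6 : ∀ {n : ℕ} (G : Graph n) (k : ℕ) (M : Rel₂ n) →
    IsMaximumMatching G M →
    (D : VSet n) →
    (∀ v → T (D v) → T (inI1 G M v)) →
    (∀ v → T (inI1 G M v) →
      count (λ u → family G M v u ∧ D u) ≡ count (family G M v) ∸ deg G v) →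
    STCyes G allV k ⇔ STCyesReduced G (λ v → not (D v)) k (decrease G D)
proposition6 G k M maxM D D⊆I₁ family-deleted = mk⇔ forward backward
  where
  unmatched : ∀ {v} → T (D v) → T (not (inVM M v))
  unmatched {v} Dv = proj₁ (T-∧⁻ {not (inVM M v)} (D⊆I₁ v Dv))
  independent : Independent G D
  independent u v Du Dv = unmatched-nonadjacent maxM (unmatched Du) (unmatched Dv)
  forward : STCyes G allV k → STCyesReduced G (λ v → not (D v)) k (decrease G D)
  forward (S , stc , weak≤k) =
    let S′ , stc′ , weak′≡weak , uncovered = deleted-uncovered-labeling maxM D⊆I₁ family-deleted stc
        kept u v s = uncovered u v s , uncovered v u (subst T (IsSTC.s-sym stc′ u v) s)
    in S′ , IsSTC-restrict kept stc′
       , subst (_≤ k) (trans (≡.sym weak′≡weak) (weakCount-split G D S′ independent kept)) weak≤k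
  backward : STCyesReduced G (λ v → not (D v)) k (decrease G D) → STCyes G allV k
  backward (S , stc , weak+decrease≤k) =
    S , IsSTC-mono (λ _ _ → _) stc
      , subst (_≤ k) (≡.sym (weakCount-split G D S independent inside)) weak+decrease≤k
    where
    inside : ∀ u v → T (S u v) → T (not (D u)) × T (not (D v))
    inside u v = proj₂ ∘ IsSTC.s-edge stc u v
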